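{- Let $G$ be a graph and let $v$ be a vertex of maximum degree in $G$. In the graph $H_v$, every vertex $u\in N_1$ that has $s$ neighbors in $N_2$ has at least $s$ neighbors in $N_1$.
   Context: For a vertex $v$ of $G$, let $N_1=N_G(v)$ be the set of neighbors of $v$ and $N_2$ the set of vertices at distance exactly $2$ from $v$. The graph $H_v$ has vertex set $N_1\cup N_2$; for $u\in N_1$, $u'\in N_2$, $(u,u')$ is an edge of $H_v$ iff it is an edge of $G$; for $u,u'\in N_1$, $(u,u')$ is an edge of $H_v$ iff it is not an edge of $G$; there are no edges of $H_v$ between vertices of $N_2$. -}

module Defs where

open import Data.Nat using (ℕ; _≤_)
open import Data.Bool using (Bool; true; false; _∧_; _∨_; not; T)
open import Data.Fin using (Fin; _≟_)
open import Data.List using (List; filter; length; allFin)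
open import Data.Bool.ListAction using (any)
open import Relation.Nullary.Decidable using (⌊_⌋; T?)
open import Relation.Binary.PropositionalEquality using (_≡_)

record SimpleGraph (n : ℕ) : Set where
  field
    adj    : Fin n → Fin n → Bool
    sym    : ∀ x y → adj x y ≡ adj y x
    irrefl : ∀ x → adj x x ≡ false

module _ {n : ℕ} (G : SimpleGraph n) where
  open SimpleGraph G

  count : (Fin n → Bool) → ℕ
  count p = length (filter (λ w → T? (p w)) (allFin n))

  degree : Fin n → ℕ
  degree x = count (adj x)

  IsMaxDegree : Fin n → Set
  IsMaxDegree v = ∀ x → degree x ≤ degree v

  inN1 : Fin n → Fin n → Bool
  inN1 v y = adj v y

  inN2 : Fin n → Fin n → Bool
  inN2 v y = not ⌊ y ≟ v ⌋ ∧ not (adj v y) ∧ any (λ w → adj v w ∧ adj w y) (allFin n)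

  Hadj : Fin n → Fin n → Fin n → Bool
  Hadj v a b =
      (inN1 v a ∧ inN2 v b ∧ adj a b)
    ∨ (inN2 v a ∧ inN1 v b ∧ adj a b)
    ∨ (inN1 v a ∧ inN1 v b ∧ not ⌊ a ≟ b ⌋ ∧ not (adj a b))

  HdegN1 : Fin n → Fin n → ℕ
  HdegN1 v u = count (λ w → inN1 v w ∧ Hadj v u w)

  HdegN2 : Fin n → Fin n → ℕ
  HdegN2 v u = count (λ w → inN2 v w ∧ Hadj v u w)

-- For u ∈ N₁, its H_v-neighbours in N₂ are G-neighbours of u that are neither v nor
-- adjacent to v, and its H_v-neighbours in N₁ are exactly the neighbours of v that are
-- neither u nor adjacent to u.  Splitting the neighbourhoods of the adjacent vertices
-- u and v into common neighbours, the other endpoint, and the rest gives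
--   deg u = |N(u) ∩ N(v)| + 1 + |N(u) ∖ N[v]|,   deg v = |N(u) ∩ N(v)| + 1 + |N(v) ∖ N[u]|,
-- so deg u ≤ deg v yields |N(u) ∖ N[v]| ≤ |N(v) ∖ N[u]|, which is the claim.
module Submission where

open import Defs
open import Data.Nat using (ℕ; suc; _+_; _≤_; s≤s⁻¹)
open import Data.Nat.Properties using (+-suc; +-cancelˡ-≤; module ≤-Reasoning)
open import Data.Bool using (Bool; true; false; _∧_; _∨_; not; T)
open import Data.Bool.Properties using (T-≡; ∧-zeroʳ; ∧-comm; ∨-identityʳ)
open import Data.Fin using (Fin; _≟_)
open import Data.List using (List; []; _∷_; filter; length; allFin)
open import Data.List.Properties using (filter-≐; filter-none)
open import Data.List.Membership.Propositional using (_∈_)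
open import Data.List.Membership.Propositional.Properties using (∈-allFin)
open import Data.List.Relation.Unary.All as All using ()
open import Data.List.Relation.Unary.Any using (here; there)
open import Data.List.Relation.Unary.Unique.Propositional using (Unique; _∷_)
open import Data.List.Relation.Unary.Unique.Propositional.Properties using (allFin⁺)
open import Data.List.Relation.Binary.Sublist.Propositional using (⊆-refl)
open import Data.List.Relation.Binary.Sublist.Propositional.Properties using (filter⁺; length-mono-≤)
open import Data.Product using (_,_)
open import Function using (_∘_; Equivalence)
open import Relation.Binary.Definitions using (DecidableEquality)
open import Relation.Binary.PropositionalEquality
open import Relation.Nullary using (contradiction)
open import Relation.Nullary.Decidable using (⌊_⌋; T?; yes; no; toWitness)

-- count G p from Defs unfolds to countIn p (allFin n).
module _ {a} {A : Set a} where

  countIn : (A → Bool) → List A → ℕ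
  countIn p xs = length (filter (T? ∘ p) xs)

  countIn-mono : ∀ {p q : A → Bool} xs → (∀ x → p x ≡ true → q x ≡ true) →
                 countIn p xs ≤ countIn q xs
  countIn-mono {p} {q} xs p⇒q =
    length-mono-≤ (filter⁺ (T? ∘ p) (T? ∘ q) (λ { refl → Tp⇒Tq }) (⊆-refl {x = xs}))
    where
    Tp⇒Tq : ∀ {x} → T (p x) → T (q x)
    Tp⇒Tq {x} = Equivalence.from T-≡ ∘ p⇒q x ∘ Equivalence.to T-≡

  countIn-cong : ∀ {p q : A → Bool} xs → (∀ x → p x ≡ q x) → countIn p xs ≡ countIn q xs
  countIn-cong {p} {q} xs p≗q = cong length (filter-≐ (T? ∘ p) (T? ∘ q) P≐Q xs)
    where
    P≐Q = (λ {x} → subst T (p≗q x)) , (λ {x} → subst T (sym (p≗q x)))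

  countIn-∧-split : ∀ (p q : A → Bool) xs →
    countIn p xs ≡ countIn (λ x → p x ∧ q x) xs + countIn (λ x → p x ∧ not (q x)) xs
  countIn-∧-split p q [] = refl
  countIn-∧-split p q (y ∷ ys) with p y | q y | countIn-∧-split p q ys
  ... | true  | true  | ih = cong suc ih
  ... | true  | false | ih = trans (cong suc ih) (sym (+-suc _ _))
  ... | false | _     | ih = ih

  module _ (_≟_ : DecidableEquality A) where

    countIn-≟-unique : ∀ {x xs} → Unique xs → x ∈ xs → countIn (λ w → ⌊ w ≟ x ⌋) xs ≡ 1
    countIn-≟-unique {x} {y ∷ ys} (y∉ys ∷ _) x∈ with y ≟ x
    ... | yes refl = cong (suc ∘ length) (filter-none (T? ∘ λ w → ⌊ w ≟ x ⌋) ys≢x)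
      where ys≢x = All.map (λ y≢w w≡y → y≢w (sym (toWitness w≡y))) y∉ys
    countIn-≟-unique (_ ∷ _)    (here refl)  | no y≢x = contradiction refl y≢x
    countIn-≟-unique (_ ∷ uniq) (there x∈ys) | no _   = countIn-≟-unique uniq x∈ys

    countIn-remove : ∀ {p : A → Bool} {x xs} → Unique xs → x ∈ xs → p x ≡ true →
                     countIn p xs ≡ suc (countIn (λ w → p w ∧ not ⌊ w ≟ x ⌋) xs)
    countIn-remove {p} {x} {xs} uniq x∈xs px = begin
      countIn p xs
        ≡⟨ countIn-∧-split p (λ w → ⌊ w ≟ x ⌋) xs ⟩
      countIn (λ w → p w ∧ ⌊ w ≟ x ⌋) xs + rest
        ≡⟨ cong (_+ rest) (countIn-cong xs p∧≟x≗≟x) ⟩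
      countIn (λ w → ⌊ w ≟ x ⌋) xs + rest
        ≡⟨ cong (_+ rest) (countIn-≟-unique uniq x∈xs) ⟩
      suc rest ∎
      where
      open ≡-Reasoning
      rest = countIn (λ w → p w ∧ not ⌊ w ≟ x ⌋) xs
      p∧≟x≗≟x : ∀ w → p w ∧ ⌊ w ≟ x ⌋ ≡ ⌊ w ≟ x ⌋
      p∧≟x≗≟x w with w ≟ x
      ... | yes refl rewrite px = refl
      ... | no _ = ∧-zeroʳ (p w)

∧-∨-disjointˡ : ∀ x b f r → (b ≡ true → x ≡ false) → x ∧ ((x ∧ f) ∨ (b ∧ r)) ≡ x ∧ f
∧-∨-disjointˡ false b     f r _ = refl
∧-∨-disjointˡ true  false f r _ = ∨-identityʳ f
∧-∨-disjointˡ true  true  f r b⇒¬x with () ← b⇒¬x refl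

∧-∨-disjointʳ : ∀ x b f r → (b ≡ true → x ≡ false) → b ∧ ((x ∧ f) ∨ (b ∧ r)) ≡ b ∧ r
∧-∨-disjointʳ x     false f r _ = refl
∧-∨-disjointʳ false true  f r _ = refl
∧-∨-disjointʳ true  true  f r b⇒¬x with () ← b⇒¬x refl

module _ {n : ℕ} (G : SimpleGraph n) where
  open SimpleGraph G using (adj; irrefl) renaming (sym to adj-sym)

  commonNbr : Fin n → Fin n → Fin n → Bool
  commonNbr x y w = adj x w ∧ adj y w

  privateNbr : Fin n → Fin n → Fin n → Bool
  privateNbr x y w = (adj x w ∧ not (adj y w)) ∧ not ⌊ w ≟ y ⌋

  degree-split : ∀ {x y} → adj x y ≡ true →
                 degree G x ≡ count G (commonNbr x y) + suc (count G (privateNbr x y))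
  degree-split {x} {y} xy = begin
    degree G x
      ≡⟨ countIn-∧-split (adj x) (adj y) (allFin n) ⟩
    count G (commonNbr x y) + count G (λ w → adj x w ∧ not (adj y w))
      ≡⟨ cong (count G (commonNbr x y) +_) (countIn-remove _≟_ (allFin⁺ n) (∈-allFin y) y∈N[x]∖N[y]) ⟩
    count G (commonNbr x y) + suc (count G (privateNbr x y)) ∎
    where
    open ≡-Reasoning
    y∈N[x]∖N[y] : adj x y ∧ not (adj y y) ≡ true
    y∈N[x]∖N[y] rewrite xy | irrefl y = refl

  privateNbr-≤ : ∀ {v u} → IsMaxDegree G v → adj v u ≡ true →
                 count G (privateNbr u v) ≤ count G (privateNbr v u)
  privateNbr-≤ {v} {u} max vu = s≤s⁻¹ (+-cancelˡ-≤ (count G (commonNbr u v)) _ _ deg≤)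
    where
    common-comm : count G (commonNbr v u) ≡ count G (commonNbr u v)
    common-comm = countIn-cong (allFin n) (λ w → ∧-comm (adj v w) (adj u w))
    deg≤ : count G (commonNbr u v) + suc (count G (privateNbr u v))
         ≤ count G (commonNbr u v) + suc (count G (privateNbr v u))
    deg≤ = subst₂ _≤_ (degree-split (trans (adj-sym u v) vu))
             (trans (degree-split vu) (cong (_+ suc (count G (privateNbr v u))) common-comm))
             (max u)

  module _ (v : Fin n) where

    N1-disjoint-N2 : ∀ {y} → inN1 G v y ≡ true → inN2 G v y ≡ false
    N1-disjoint-N2 {y} vy rewrite vy = ∧-zeroʳ (not ⌊ y ≟ v ⌋)

    Hadj-from-N1 : ∀ {u} → inN1 G v u ≡ true → ∀ w →
      Hadj G v u w ≡ (inN2 G v w ∧ adj u w) ∨ (inN1 G v w ∧ not ⌊ u ≟ w ⌋ ∧ not (adj u w))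
    Hadj-from-N1 {u} vu w = select (inN1 G v u) (inN2 G v u) vu (N1-disjoint-N2 vu)
      where
      select : ∀ d e {X Y Z} → d ≡ true → e ≡ false → (d ∧ X) ∨ (e ∧ Y) ∨ (d ∧ Z) ≡ X ∨ Z
      select _ _ refl refl = refl

    N2∧adj⇒privateNbr : ∀ {u} w → inN2 G v w ∧ adj u w ≡ true → privateNbr u v w ≡ true
    N2∧adj⇒privateNbr {u} w h with w ≟ v | adj v w | adj u w | h
    ... | yes _ | _     | _     | ()
    ... | no _  | true  | _     | ()
    ... | no _  | false | true  | _ = refl
    ... | no _  | false | false | h′ with () ← trans (sym (∧-zeroʳ _)) h′

    privateNbr⇒N1-non-nbr : ∀ {u} w → privateNbr v u w ≡ true →
                            inN1 G v w ∧ not ⌊ u ≟ w ⌋ ∧ not (adj u w) ≡ true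
    privateNbr⇒N1-non-nbr {u} w h with adj v w | adj u w | w ≟ u | u ≟ w | h
    ... | true  | false | no _   | no _      | _ = refl
    ... | true  | false | no w≢u | yes refl  | _ = contradiction refl w≢u
    ... | true  | false | yes _  | _         | ()
    ... | true  | true  | _      | _         | ()
    ... | false | _     | _      | _         | ()

    HdegN2-from-N1 : ∀ {u} → inN1 G v u ≡ true → HdegN2 G v u ≡ count G (λ w → inN2 G v w ∧ adj u w)
    HdegN2-from-N1 {u} vu = countIn-cong (allFin n) λ w →
      trans (cong (inN2 G v w ∧_) (Hadj-from-N1 vu w))
            (∧-∨-disjointˡ (inN2 G v w) (inN1 G v w) _ _ N1-disjoint-N2)

    HdegN1-from-N1 : ∀ {u} → inN1 G v u ≡ true →
                     HdegN1 G v u ≡ count G (λ w → inN1 G v w ∧ not ⌊ u ≟ w ⌋ ∧ not (adj u w))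
    HdegN1-from-N1 {u} vu = countIn-cong (allFin n) λ w →
      trans (cong (inN1 G v w ∧_) (Hadj-from-N1 vu w))
            (∧-∨-disjointʳ (inN2 G v w) (inN1 G v w) _ _ N1-disjoint-N2)

lemma9 : ∀ {n : ℕ} (G : SimpleGraph n) (v : Fin n) → IsMaxDegree G v →
         ∀ (u : Fin n) → inN1 G v u ≡ true →
         ∀ (s : ℕ) → HdegN2 G v u ≡ s → s ≤ HdegN1 G v u
lemma9 {n} G v max u vu s refl = begin
  HdegN2 G v u                                            ≡⟨ HdegN2-from-N1 G v vu ⟩
  count G (λ w → inN2 G v w ∧ adj u w)                    ≤⟨ countIn-mono (allFin n) (N2∧adj⇒privateNbr G v) ⟩
  count G (privateNbr G u v)                              ≤⟨ privateNbr-≤ G max vu ⟩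
  count G (privateNbr G v u)                              ≤⟨ countIn-mono (allFin n) (privateNbr⇒N1-non-nbr G v) ⟩
  count G (λ w → inN1 G v w ∧ not ⌊ u ≟ w ⌋ ∧ not (adj u w)) ≡⟨ HdegN1-from-N1 G v vu ⟨
  HdegN1 G v u                                            ∎
  where
  open ≤-Reasoning
  open SimpleGraph G using (adj)
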